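{- Let $G=(V,E)$ be a directed graph, $s\neq t$ vertices, $k\ge 5$ an integer, and let $(u,v)$ be an undetermined edge. For each $w\in D$ let $\widehat{In}_D(w)$ be any set of $k-2$ vertices of $In_D(w)$ if $|In_D(w)|>k-2$, and $\widehat{In}_D(w)=In_D(w)$ otherwise. Then $(u,v)$ is an edge of $SPG_k(s,t)$ if and only if there exists a simple path $q^\ast=\{v_2,v_3,\ldots,v_{l-2}\}$ in $G$ passing through the edge $(u,v)$, of length $l-4\le k-4$, such that (1) $v_2\in D$ and $v_{l-2}\in A$; and (2) there exist $v_1\in \widehat{In}_D(v_2)$ and $v_{l-1}\in Out_A(v_{l-2})$ such that the vertices $s,v_1,v_2,\ldots,v_{l-1},t$ are pairwise distinct.
   Context: A path from $x$ to $y$ is a vertex sequence $x=v_0,\ldots,v_l=y$ with $(v_{i-1},v_i)\in E$; its length is $l$ (length $0$ allowed); $V(p)$ is its vertex set; it is simple if its vertices are pairwise distinct. $P_l^\ast(x,y)$ is the set of simple paths from $x$ to $y$ of length at most $l$. $SPG_k(s,t)$ is the subgraph of $G$ formed by the union of vertices and edges of all simple $s$-$t$ paths of length at most $k$. Essential vertices: $EV_l^\ast(s,u)=\bigcap\{V(p): p\in P_l^\ast(s,u),\ t\notin V(p)\}$ and $EV_l^\ast(v,t)=\bigcap\{V(p): p\in P_l^\ast(v,t),\ s\notin V(p)\}$; $EV_l^\ast(s,u)$ exists iff some $p\in P_l^\ast(s,u)$ has $t\notin V(p)$, and $EV_l^\ast(v,t)$ exists iff some $p\in P_l^\ast(v,t)$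 has $s\notin V(p)$. The upper-bound edge set $E^u$ consists of all $(u,v)\in E$ for which there exist nonnegative integers $k_f,k_b$ with $k_f+1+k_b\le k$ such that $EV^\ast_{k_f}(s,u)$ and $EV^\ast_{k_b}(v,t)$ exist and are disjoint. An edge $(u,v)\in E$ is definite if (a) $u=s$ and $EV^\ast_{k-1}(v,t)$ exists; or (b) $v=t$ and $EV^\ast_{k-1}(s,u)$ exists; or (c) $EV^\ast_1(s,u)$, $EV^\ast_{k-2}(v,t)$ exist and $u\notin EV^\ast_{k-2}(v,t)$; or (d) $EV^\ast_1(v,t)$, $EV^\ast_{k-2}(s,u)$ exist and $v\notin EV^\ast_{k-2}(s,u)$. An undetermined edge is an edge of $E^u$ that is not definite. Departures: $v\in D$ iff there is $x$ with $(x,v)\in E$ such that $x,v,s,t$ are pairwise distinct and $(s,x),(x,v)\in E^u$; for $v\in D$, $In_D(v)$ is the set of all such $x$. Arrivals: $v\in A$ iff there is $y$ with $(v,y)\in E$ such that $v,y,s,t$ are pairwise distinct and $(v,y),(y,t)\in E^u$; for $v\in A$, $Out_A(v)$ is the set of all such $y$. -}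

module Defs where

open import Level using (0ℓ)
open import Data.Nat using (ℕ; _+_; _∸_; _≤_; _<_; suc)
open import Data.Fin using (Fin)
open import Data.List using (List; []; _∷_; _++_; length; head; last)
open import Data.List.Relation.Unary.Linked using (Linked)
open import Data.List.Relation.Unary.All using (All)
open import Data.List.Relation.Unary.Unique.Propositional using (Unique)
open import Data.List.Membership.Propositional using (_∈_; _∉_)
open import Data.Maybe using (just)
open import Data.Product using (Σ; ∃; ∃-syntax; _×_)
open import Data.Sum using (_⊎_)
open import Relation.Binary using (Rel)
open import Relation.Binary.PropositionalEquality using (_≡_; _≢_)
open import Relation.Nullary using (¬_)
open import Function.Bundles using (_⇔_)

module Graph {n : ℕ} (E : Rel (Fin n) 0ℓ) (s t : Fin n) (k : ℕ) where

  V : Set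
  V = Fin n

  -- A path is represented by its vertex sequence (nonempty list);
  -- its length is (number of vertices - 1).
  -- ps is a path from x to y of length ≤ l
  PathLe : ℕ → V → V → List V → Set
  PathLe l x y ps =
    Linked E ps × head ps ≡ just x × last ps ≡ just y × length ps ≤ suc l

  SimplePathLe : ℕ → V → V → List V → Set
  SimplePathLe l x y ps = PathLe l x y ps × Unique ps

  EVsExists : ℕ → V → Set
  EVsExists l u = ∃[ ps ] (SimplePathLe l s u ps × t ∉ ps)

  EVs : ℕ → V → V → Set
  EVs l u w = ∀ ps → SimplePathLe l s u ps → t ∉ ps → w ∈ ps

  EVtExists : ℕ → V → Set
  EVtExists l v = ∃[ ps ] (SimplePathLe l v t ps × s ∉ ps)

  EVt : ℕ → V → V → Set
  EVt l v w = ∀ ps → SimplePathLe l v t ps → s ∉ ps → w ∈ ps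

  InEu : V → V → Set
  InEu u v = E u v × ∃[ kf ] ∃[ kb ] (kf + 1 + kb ≤ k × EVsExists kf u × EVtExists kb v
                                        × ¬ (∃[ w ] (EVs kf u w × EVt kb v w)))

  Definite : V → V → Set
  Definite u v =
      (u ≡ s × EVtExists (k ∸ 1) v)
    ⊎ (v ≡ t × EVsExists (k ∸ 1) u)
    ⊎ (EVsExists 1 u × EVtExists (k ∸ 2) v × ¬ EVt (k ∸ 2) v u)
    ⊎ (EVtExists 1 v × EVsExists (k ∸ 2) u × ¬ EVs (k ∸ 2) u v)

  Undetermined : V → V → Set
  Undetermined u v = InEu u v × ¬ Definite u v

  Distinct4 : V → V → V → V → Set
  Distinct4 a b c d = Unique (a ∷ b ∷ c ∷ d ∷ [])

  InD : V → V → Set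
  InD v x = E x v × Distinct4 x v s t × InEu s x × InEu x v

  Dep : V → Set
  Dep v = ∃[ x ] InD v x

  OutA : V → V → Set
  OutA v y = E v y × Distinct4 v y s t × InEu v y × InEu y t

  Arr : V → Set
  Arr v = ∃[ y ] OutA v y

  EdgeIn : V → V → List V → Set
  EdgeIn u v ps = ∃[ as ] ∃[ bs ] (ps ≡ as ++ (u ∷ v ∷ bs))

  InSPG : V → V → Set
  InSPG u v = ∃[ ps ] (SimplePathLe k s t ps × EdgeIn u v ps)

  MoreThan : ℕ → (V → Set) → Set
  MoreThan m P = ∃[ xs ] (Unique xs × All P xs × m < length xs)

  HasSize : ℕ → (V → Set) → Set
  HasSize m P = ∃[ xs ] (Unique xs × length xs ≡ m × (∀ x → (P x ⇔ (x ∈ xs))))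

  -- H is an admissible choice of the sets \hat{In}_D(w), w ∈ D:
  -- a (k-2)-subset of In_D(w) if |In_D(w)| > k-2, and In_D(w) otherwise
  IsHatIn : (V → V → Set) → Set
  IsHatIn H = ∀ w → Dep w →
      (MoreThan (k ∸ 2) (InD w) → HasSize (k ∸ 2) (H w) × (∀ x → H w x → InD w x))
    × (¬ MoreThan (k ∸ 2) (InD w) → ∀ x → (H w x ⇔ InD w x))

  Witness : (V → V → Set) → V → V → Set
  Witness H u v =
    ∃[ qs ] ∃[ v₂ ] ∃[ vₗ₋₂ ]
      ( Linked E qs × Unique qs × head qs ≡ just v₂ × last qs ≡ just vₗ₋₂
      × length qs ≤ k ∸ 3
      × EdgeIn u v qs
      × Dep v₂ × Arr vₗ₋₂
      × ∃[ v₁ ] ∃[ vₗ₋₁ ]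
          ( H v₂ v₁ × OutA vₗ₋₂ vₗ₋₁
          × Unique (s ∷ v₁ ∷ (qs ++ (vₗ₋₁ ∷ t ∷ [])))))

-- An s–t path of length ≤ k through the undetermined edge (u, v) cannot use (u, v) as one of its
-- first two or last two edges: each of these positions exhibits one of the four conditions that make
-- an edge definite. So the path reads s, v₁, q*, vₗ₋₁, t with (u, v) on q*. Every edge of a simple
-- s–t path of length ≤ k lies in Eᵘ (the prefix and suffix at that edge have disjoint vertex sets),
-- hence v₁ ∈ In_D(v₂) and vₗ₋₁ ∈ Out_A(vₗ₋₂). If v₁ is not among the chosen vertices \hat{In}_D(v₂),
-- these are k − 2 elements of In_D(v₂), so distinct from v₂, s and t, while the other vertices of q*
-- together with vₗ₋₁ number at most k − 3; one of them therefore replaces v₁. Conversely a witness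
-- closes up into a simple s–t path of length ≤ k through (u, v). As \hat{In}_D is specified by a case
-- split on |In_D(w)| > k − 2, the proof decides In_D, and with it Eᵘ and the essential vertex sets,
-- by enumerating the finitely many vertex lists of bounded length.

module Submission where

open import Defs
open import Level using (0ℓ)
open import Function using (_∘_)
open import Data.Nat using (ℕ; suc; _+_; _∸_; _≤_; _<_; _≤?_; _<?_; z≤n; s≤s)
open import Data.Nat.Properties
  using ( ≤-refl; ≤-trans; ≤-reflexive; ≤-pred; <-≤-trans; ≤-<-trans; ≮⇒≥; +-comm; +-assoc; +-suc
        ; m+n≤o⇒m≤o; m+n≤o⇒n≤o; m+n≤o⇒m≤o∸n; m≤o∸n⇒m+n≤o; anyUpTo?)
open import Data.Fin using (Fin)
open import Data.Fin.Properties using (_≟_) renaming (any? to anyFin?)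
open import Data.List
  using (List; []; _∷_; [_]; _++_; _∷ʳ_; length; head; last; filter; allFin; cartesianProductWith; initLast; _∷ʳ′_)
open import Data.List.Properties using (length-++; ++-assoc; ∷ʳ-++; filter-notAll)
open import Data.List.Relation.Unary.Linked as Linked using (Linked; []; [-]; _∷_; linked?)
open import Data.List.Relation.Unary.Any as Any using (here; there; any?; satisfied)
open import Data.List.Relation.Unary.All as All using (All; []; _∷_; all?)
open import Data.List.Relation.Unary.All.Properties using (¬Any⇒All¬; all-filter)
  renaming (++⁻ˡ to All-++⁻ˡ; ++⁻ʳ to All-++⁻ʳ)
open import Data.List.Relation.Unary.AllPairs using ([]; _∷_)
open import Data.List.Relation.Unary.Unique.Propositional using (Unique)
import Data.List.Relation.Unary.Unique.Propositional.Properties as Unique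
open import Data.List.Membership.Propositional using (_∈_; _∉_; lose)
open import Data.List.Membership.Propositional.Properties
  using (∈-++⁺ˡ; ∈-++⁻; ∈-cartesianProductWith⁺; ∈-allFin; ∈-filter⁺)
open import Data.Maybe using (just)
open import Data.Maybe.Properties using (just-injective; ≡-dec)
open import Data.Product using (∃; ∃-syntax; _×_; _,_; proj₁; proj₂)
open import Data.Sum using (inj₁; inj₂)
open import Data.Empty using (⊥-elim)
open import Relation.Binary using (Rel; Decidable; DecidableEquality)
open import Relation.Binary.PropositionalEquality
  using (_≡_; _≢_; refl; sym; trans; cong; subst; ≢-sym; module ≡-Reasoning)
open import Relation.Nullary using (¬_; Dec; yes; no; ¬?)
open import Relation.Nullary.Decidable using (_×-dec_; _→-dec_; map′)
open import Relation.Unary using (Pred)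
open import Function.Bundles using (_⇔_; mk⇔; Equivalence)

module _ {A : Set} where

  Linked-++⁻ˡ : ∀ {R : Rel A 0ℓ} xs {ys} → Linked R (xs ++ ys) → Linked R xs
  Linked-++⁻ˡ []           _        = []
  Linked-++⁻ˡ (x ∷ [])     _        = [-]
  Linked-++⁻ˡ (x ∷ y ∷ xs) (r ∷ rs) = r ∷ Linked-++⁻ˡ (y ∷ xs) rs

  Linked-++⁻ʳ : ∀ {R : Rel A 0ℓ} xs {ys} → Linked R (xs ++ ys) → Linked R ys
  Linked-++⁻ʳ []       rs = rs
  Linked-++⁻ʳ (x ∷ xs) rs = Linked-++⁻ʳ xs (Linked.tail rs)

  Linked-bridge : ∀ {R : Rel A 0ℓ} {x a b y} qs {ys} →
                  Linked R qs → head qs ≡ just a → last qs ≡ just b →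
                  R x a → R b y → Linked R (y ∷ ys) → Linked R (x ∷ qs ++ y ∷ ys)
  Linked-bridge []            _        ()   _    _   _   _
  Linked-bridge (a ∷ [])      _        refl refl Rxa Rby rs = Rxa ∷ Rby ∷ rs
  Linked-bridge (a ∷ a′ ∷ qs) (r ∷ rq) refl ls   Rxa Rby rs = Rxa ∷ Linked-bridge (a′ ∷ qs) rq refl ls r Rby rs

  Unique-++⁻ˡ : ∀ xs {ys : List A} → Unique (xs ++ ys) → Unique xs
  Unique-++⁻ˡ []       _        = []
  Unique-++⁻ˡ (x ∷ xs) (x∉ ∷ u) = All-++⁻ˡ xs x∉ ∷ Unique-++⁻ˡ xs u

  Unique-++⁻ʳ : ∀ xs {ys : List A} → Unique (xs ++ ys) → Unique ys
  Unique-++⁻ʳ []       u       = u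
  Unique-++⁻ʳ (x ∷ xs) (_ ∷ u) = Unique-++⁻ʳ xs u

  Unique-∷⇒≢ : ∀ {x y : A} {xs} → Unique (x ∷ xs) → y ∈ xs → x ≢ y
  Unique-∷⇒≢ (x≢ ∷ _) y∈xs = All.lookup x≢ y∈xs

  Unique-++⇒disjoint : ∀ xs {ys : List A} {z} → Unique (xs ++ ys) → z ∈ xs → z ∉ ys
  Unique-++⇒disjoint (x ∷ xs) (x≢ ∷ _) (here refl)  z∈ys = All.lookup (All-++⁻ʳ xs x≢) z∈ys refl
  Unique-++⇒disjoint (x ∷ xs) (_ ∷ u)  (there z∈xs) = Unique-++⇒disjoint xs u z∈xs

  Unique-replace-second : ∀ {x y z : A} {xs} → Unique (x ∷ y ∷ xs) → z ≢ x → z ∉ xs → Unique (x ∷ z ∷ xs)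
  Unique-replace-second ((_ ∷ x∉xs) ∷ (_ ∷ u)) z≢x z∉xs = (≢-sym z≢x ∷ x∉xs) ∷ (¬Any⇒All¬ _ z∉xs ∷ u)

  distinct4 : ∀ {a b c d : A} → a ≢ b → a ≢ c → a ≢ d → b ≢ c → b ≢ d → c ≢ d → Unique (a ∷ b ∷ c ∷ d ∷ [])
  distinct4 ab ac ad bc bd cd = (ab ∷ ac ∷ ad ∷ []) ∷ (bc ∷ bd ∷ []) ∷ (cd ∷ []) ∷ [] ∷ []

  head-∷ʳ-++ : ∀ xs (x : A) ys → head ((xs ∷ʳ x) ++ ys) ≡ head (xs ∷ʳ x)
  head-∷ʳ-++ []      x ys = refl
  head-∷ʳ-++ (_ ∷ _) x ys = refl

  last-++-∷ : ∀ xs (y : A) ys → last (xs ++ y ∷ ys) ≡ last (y ∷ ys)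
  last-++-∷ []            y ys = refl
  last-++-∷ (x ∷ [])      y ys = refl
  last-++-∷ (x ∷ x′ ∷ xs) y ys = last-++-∷ (x′ ∷ xs) y ys

  head⇒∈ : ∀ {xs} {x : A} → head xs ≡ just x → x ∈ xs
  head⇒∈ {_ ∷ _} refl = here refl

  last⇒∈ : ∀ xs {x : A} → last xs ≡ just x → x ∈ xs
  last⇒∈ (y ∷ [])      refl = here refl
  last⇒∈ (y ∷ y′ ∷ xs) eq   = there (last⇒∈ (y′ ∷ xs) eq)

  ∈-∷ʳ⇒∈-++-∷ : ∀ {z : A} xs {w ys} → z ∈ xs ∷ʳ w → z ∈ xs ++ w ∷ ys
  ∈-∷ʳ⇒∈-++-∷ xs {w} {ys} z∈ = subst (_ ∈_) (∷ʳ-++ xs w ys) (∈-++⁺ˡ z∈)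

  ∉-extend : ∀ {y q w t : A} xs → y ≢ q → y ∉ xs ∷ʳ w → y ≢ t → y ∉ q ∷ xs ++ w ∷ t ∷ []
  ∉-extend xs y≢q _ _ (here y≡q) = y≢q y≡q
  ∉-extend {w = w} {t} xs _ y∉xs∷ʳw y≢t (there y∈) with ∈-++⁻ (xs ∷ʳ w) (subst (_ ∈_) (sym (∷ʳ-++ xs w [ t ])) y∈)
  ... | inj₁ y∈xs∷ʳw    = y∉xs∷ʳw y∈xs∷ʳw
  ... | inj₂ (here y≡t) = y≢t y≡t

  snoc-view : ∀ (x : A) xs → ∃[ ys ] ∃[ y ] (x ∷ xs ≡ ys ∷ʳ y)
  snoc-view x []       = [] , x , refl
  snoc-view x (x′ ∷ xs) with snoc-view x′ xs
  ... | ys , y , eq = x ∷ ys , y , cong (x ∷_) eq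

  length-∷ʳ : ∀ xs (x : A) → length (xs ∷ʳ x) ≡ suc (length xs)
  length-∷ʳ xs x = trans (length-++ xs) (+-comm (length xs) 1)

  length-split : ∀ pre (x y : A) post → length (pre ++ x ∷ y ∷ post) ≡ suc (length pre + 1 + length post)
  length-split pre x y post = begin
    length (pre ++ x ∷ y ∷ post)               ≡⟨ length-++ pre ⟩
    length pre + suc (suc (length post))       ≡⟨ +-suc (length pre) (suc (length post)) ⟩
    suc (length pre + (1 + length post))       ≡⟨ cong suc (+-assoc (length pre) 1 (length post)) ⟨
    suc (length pre + 1 + length post)         ∎
    where open ≡-Reasoning

  length-between : ∀ (a b : A) qs (c d : A) → length (a ∷ b ∷ qs ++ c ∷ d ∷ []) ≡ suc (length qs + 3)
  length-between a b qs c d = trans (cong (suc ∘ suc) (length-++ qs)) (cong suc (sym (+-suc (length qs) 2)))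

  interior-reassoc : ∀ (as : List A) u v ys w b →
                     as ++ u ∷ v ∷ ((ys ∷ʳ w) ∷ʳ b) ≡ (as ++ u ∷ v ∷ ys) ++ w ∷ b ∷ []
  interior-reassoc as u v ys w b = begin
    as ++ u ∷ v ∷ ((ys ∷ʳ w) ∷ʳ b)    ≡⟨ cong (λ zs → as ++ u ∷ v ∷ zs) (++-assoc ys [ w ] [ b ]) ⟩
    as ++ u ∷ v ∷ ys ++ w ∷ b ∷ []    ≡⟨ ++-assoc as (u ∷ v ∷ ys) (w ∷ b ∷ []) ⟨
    (as ++ u ∷ v ∷ ys) ++ w ∷ b ∷ []  ∎
    where open ≡-Reasoning

module _ {A : Set} (_≟ᴬ_ : DecidableEquality A) where

  unique-longer⇒∃∉ : ∀ {xs ys : List A} → Unique xs → length ys < length xs → ∃[ x ] (x ∈ xs × x ∉ ys)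
  unique-longer⇒∃∉ {x ∷ xs} {ys} (x∉xs ∷ u) |ys|< with any? (x ≟ᴬ_) ys
  ... | no x∉ys = x , here refl , x∉ys
  ... | yes x∈ys with unique-longer⇒∃∉ u (<-≤-trans |ys∖x|<|ys| (≤-pred |ys|<))
    where
    |ys∖x|<|ys| : length (filter (λ y → ¬? (y ≟ᴬ x)) ys) < length ys
    |ys∖x|<|ys| = filter-notAll _ ys (Any.map (λ { refl y≢y → y≢y refl }) x∈ys)
  ... | z , z∈xs , z∉ys∖x = z , there z∈xs , λ z∈ys → z∉ys∖x (∈-filter⁺ _ z∈ys (λ z≡x → All.lookup x∉xs z∈xs (sym z≡x)))

  unique-⊆⇒length≤ : ∀ {xs ys : List A} → Unique xs → (∀ {x} → x ∈ xs → x ∈ ys) → length xs ≤ length ys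
  unique-⊆⇒length≤ u xs⊆ys = ≮⇒≥ λ longer →
    let (x , x∈xs , x∉ys) = unique-longer⇒∃∉ u longer in x∉ys (xs⊆ys x∈xs)

module _ {n : ℕ} where

  listsOfLength≤ : ℕ → List (List (Fin n))
  listsOfLength≤ 0       = [ [] ]
  listsOfLength≤ (suc L) = [] ∷ cartesianProductWith _∷_ (allFin n) (listsOfLength≤ L)

  ∈-listsOfLength≤ : ∀ L {xs} → length xs ≤ L → xs ∈ listsOfLength≤ L
  ∈-listsOfLength≤ 0       {[]}     _           = here refl
  ∈-listsOfLength≤ (suc L) {[]}     _           = here refl
  ∈-listsOfLength≤ (suc L) {x ∷ xs} (s≤s |xs|≤) =
    there (∈-cartesianProductWith⁺ _∷_ (∈-allFin x) (∈-listsOfLength≤ L |xs|≤))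

  module _ {Q : Pred (List (Fin n)) 0ℓ} (Q? : ∀ xs → Dec (Q xs))
           (L : ℕ) (bounded : ∀ {xs} → Q xs → length xs ≤ L) where

    bounded-∃? : Dec (∃ Q)
    bounded-∃? with any? Q? (listsOfLength≤ L)
    ... | yes found = yes (satisfied found)
    ... | no none   = no λ (xs , q) → none (lose (∈-listsOfLength≤ L (bounded q)) q)

    bounded-∀? : ∀ {R : Pred (List (Fin n)) 0ℓ} → (∀ xs → Dec (R xs)) → Dec (∀ xs → Q xs → R xs)
    bounded-∀? R? with all? (λ xs → Q? xs →-dec R? xs) (listsOfLength≤ L)
    ... | yes listed = yes λ xs q → All.lookup listed (∈-listsOfLength≤ L (bounded q)) q
    ... | no ¬listed = no λ all-R → ¬listed (All.tabulate λ {xs} _ → all-R xs)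

  moreThan? : ∀ {P : Pred (Fin n) 0ℓ} → (∀ x → Dec (P x)) → ∀ m →
              Dec (∃[ xs ] (Unique xs × All P xs × m < length xs))
  moreThan? P? m with m <? length (filter P? (allFin n))
  ... | yes m< = yes (filter P? (allFin n) , Unique.filter⁺ P? (Unique.allFin⁺ n) , all-filter P? (allFin n) , m<)
  ... | no m≮  = no λ (xs , u , all-P , m<) →
    m≮ (<-≤-trans m< (unique-⊆⇒length≤ _≟_ u λ x∈xs → ∈-filter⁺ P? (∈-allFin _) (All.lookup all-P x∈xs)))

prefix-bound : ∀ {m} n {o} → m + 1 + n ≤ o → m ≤ o ∸ (1 + n)
prefix-bound {m} n le = m+n≤o⇒m≤o∸n m (≤-trans (≤-reflexive (sym (+-assoc m 1 n))) le)

suffix-bound : ∀ m {n o} → m + 1 + n ≤ o → n ≤ o ∸ (m + 1)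
suffix-bound m {n} le = m+n≤o⇒m≤o∸n n (≤-trans (≤-reflexive (+-comm n (m + 1))) le)

interior-length≤ : ∀ {A : Set} {k} (a b : A) qs (c d : A) → 3 ≤ k →
                   length (a ∷ b ∷ qs ++ c ∷ d ∷ []) ≤ suc k ⇔ length qs ≤ k ∸ 3
interior-length≤ a b qs c d 3≤k = mk⇔
  (λ le → m+n≤o⇒m≤o∸n (length qs) (≤-pred (≤-trans (≤-reflexive (sym |path|)) le)))
  (λ le → ≤-trans (≤-reflexive |path|) (s≤s (m≤o∸n⇒m+n≤o (length qs) 3≤k le)))
  where |path| = length-between a b qs c d

∸3<∸2 : ∀ {k} → 3 ≤ k → k ∸ 3 < k ∸ 2
∸3<∸2 (s≤s (s≤s (s≤s _))) = ≤-refl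

module Paths {n : ℕ} (E : Rel (Fin n) 0ℓ) (s t : Fin n) (k : ℕ) where
  open Graph E s t k

  linked : ∀ {l a b ps} → SimplePathLe l a b ps → Linked E ps
  linked ((lk , _) , _) = lk

  starts-at : ∀ {l a b ps} → SimplePathLe l a b ps → head ps ≡ just a
  starts-at ((_ , hd , _) , _) = hd

  ends-at : ∀ {l a b ps} → SimplePathLe l a b ps → last ps ≡ just b
  ends-at ((_ , _ , ls , _) , _) = ls

  length≤ : ∀ {l a b ps} → SimplePathLe l a b ps → length ps ≤ suc l
  length≤ ((_ , _ , _ , len) , _) = len

  SimplePathLe-mono : ∀ {l l′ a b ps} → l ≤ l′ → SimplePathLe l a b ps → SimplePathLe l′ a b ps
  SimplePathLe-mono l≤l′ ((lk , hd , ls , len) , u) = (lk , hd , ls , ≤-trans len (s≤s l≤l′)) , u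

  module Split {l a b} pre x y post (p : SimplePathLe l a b (pre ++ x ∷ y ∷ post)) where

    private
      p′ : SimplePathLe l a b ((pre ∷ʳ x) ++ y ∷ post)
      p′ = subst (SimplePathLe l a b) (sym (∷ʳ-++ pre x (y ∷ post))) p

    prefix-path : SimplePathLe (length pre) a x (pre ∷ʳ x)
    prefix-path =
      let (lk , hd , _ , _) , u = p′ in
        ( Linked-++⁻ˡ (pre ∷ʳ x) lk , trans (sym (head-∷ʳ-++ pre x (y ∷ post))) hd
        , last-++-∷ pre x [] , ≤-reflexive (length-∷ʳ pre x))
      , Unique-++⁻ˡ (pre ∷ʳ x) u

    suffix-path : SimplePathLe (length post) y b (y ∷ post)
    suffix-path =
      let (lk , _ , ls , _) , u = p′ in
        (Linked-++⁻ʳ (pre ∷ʳ x) lk , refl , trans (sym (last-++-∷ (pre ∷ʳ x) y post)) ls , ≤-refl)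
      , Unique-++⁻ʳ (pre ∷ʳ x) u

    prefix-suffix-disjoint : ∀ {z} → z ∈ pre ∷ʳ x → z ∉ y ∷ post
    prefix-suffix-disjoint = Unique-++⇒disjoint (pre ∷ʳ x) (proj₂ p′)

    end∉prefix : b ∉ pre ∷ʳ x
    end∉prefix b∈ = prefix-suffix-disjoint b∈ (last⇒∈ (y ∷ post) (ends-at suffix-path))

    start∉suffix : a ∉ y ∷ post
    start∉suffix = prefix-suffix-disjoint (head⇒∈ (starts-at prefix-path))

    split-length : length pre + 1 + length post ≤ l
    split-length = ≤-pred (≤-trans (≤-reflexive (sym (length-split pre x y post))) (length≤ p))

  SPG-edge⇒InEu : ∀ pre {x y} post → SimplePathLe k s t (pre ++ x ∷ y ∷ post) → InEu x y
  SPG-edge⇒InEu pre {x} {y} post p =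
      Linked.head (Linked-++⁻ʳ pre (linked p))
    , length pre , length post , split-length
    , (pre ∷ʳ x , prefix-path , end∉prefix)
    , (y ∷ post , suffix-path , start∉suffix)
    , λ (w , w∈EVs , w∈EVt) →
        prefix-suffix-disjoint (w∈EVs _ prefix-path end∉prefix) (w∈EVt _ suffix-path start∉suffix)
    where open Split pre x y post p

  first-edge-definite : ∀ {x y} post → SimplePathLe k s t (x ∷ y ∷ post) → Definite x y
  first-edge-definite {x} {y} post p =
    inj₁ ( just-injective (starts-at prefix-path)
         , y ∷ post , SimplePathLe-mono (suffix-bound 0 split-length) suffix-path , start∉suffix)
    where open Split [] x y post p

  second-edge-definite : ∀ {a x y} post → SimplePathLe k s t (a ∷ x ∷ y ∷ post) → Definite x y
  second-edge-definite {a} {x} {y} post p =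
    inj₂ (inj₂ (inj₁ ( (a ∷ x ∷ [] , prefix-path , end∉prefix)
                     , (y ∷ post , suffix-path′ , start∉suffix)
                     , λ x∈EVt → prefix-suffix-disjoint (there (here refl)) (x∈EVt _ suffix-path′ start∉suffix))))
    where
    open Split [ a ] x y post p
    suffix-path′ : SimplePathLe (k ∸ 2) y t (y ∷ post)
    suffix-path′ = SimplePathLe-mono (suffix-bound 1 split-length) suffix-path

  last-edge-definite : ∀ pre {x y} → SimplePathLe k s t (pre ++ x ∷ y ∷ []) → Definite x y
  last-edge-definite pre {x} {y} p =
    inj₂ (inj₁ ( just-injective (ends-at suffix-path)
               , pre ∷ʳ x , SimplePathLe-mono (prefix-bound 0 split-length) prefix-path , end∉prefix))
    where open Split pre x y [] p

  second-last-edge-definite : ∀ pre {x y b} → SimplePathLe k s t (pre ++ x ∷ y ∷ b ∷ []) → Definite x y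
  second-last-edge-definite pre {x} {y} {b} p =
    inj₂ (inj₂ (inj₂ ( (y ∷ b ∷ [] , suffix-path , start∉suffix)
                     , (pre ∷ʳ x , prefix-path′ , end∉prefix)
                     , λ y∈EVs → prefix-suffix-disjoint (y∈EVs _ prefix-path′ end∉prefix) (here refl))))
    where
    open Split pre x y [ b ] p
    prefix-path′ : SimplePathLe (k ∸ 2) s x (pre ∷ʳ x)
    prefix-path′ = SimplePathLe-mono (prefix-bound 1 split-length) prefix-path

  pin-endpoints : ∀ {a b v₁ w} xs →
                  SimplePathLe k s t (a ∷ v₁ ∷ xs ++ w ∷ b ∷ []) → SimplePathLe k s t (s ∷ v₁ ∷ xs ++ w ∷ t ∷ [])
  pin-endpoints {a} {v₁ = v₁} {w} xs p
    with just-injective (starts-at p) | just-injective (trans (sym (last-++-∷ (a ∷ v₁ ∷ xs) w _)) (ends-at p))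
  ... | refl | refl = p

  undetermined-edge-interior : ∀ {u v} → ¬ Definite u v → InSPG u v →
    ∃[ v₁ ] ∃[ qs ] ∃[ w ] (SimplePathLe k s t (s ∷ v₁ ∷ qs ++ w ∷ t ∷ []) × EdgeIn u v qs)
  undetermined-edge-interior ¬def (_ , p , []    , post , refl) = ⊥-elim (¬def (first-edge-definite post p))
  undetermined-edge-interior ¬def (_ , p , _ ∷ [] , post , refl) = ⊥-elim (¬def (second-edge-definite post p))
  undetermined-edge-interior {u} {v} ¬def (_ , p , a ∷ v₁ ∷ as , post , refl) with initLast post
  ... | [] = ⊥-elim (¬def (last-edge-definite (a ∷ v₁ ∷ as) p))
  ... | post′ ∷ʳ′ b with initLast post′
  ... | [] = ⊥-elim (¬def (second-last-edge-definite (a ∷ v₁ ∷ as) p))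
  ... | ys ∷ʳ′ w =
    v₁ , as ++ u ∷ v ∷ ys , w
    , pin-endpoints (as ++ u ∷ v ∷ ys)
        (subst (λ zs → SimplePathLe k s t (a ∷ v₁ ∷ zs)) (interior-reassoc as u v ys w b) p)
    , as , ys , refl

  departure-on-path : s ≢ t → ∀ {x y} rest → SimplePathLe k s t (s ∷ x ∷ y ∷ rest) → t ∈ rest → InD y x
  departure-on-path s≢t {x} {y} rest p t∈rest =
    proj₁ x→y , distinct4 x≢y x≢s x≢t y≢s y≢t s≢t , SPG-edge⇒InEu [] (y ∷ rest) p , x→y
    where
    x→y : InEu x y
    x→y = SPG-edge⇒InEu [ s ] rest p
    u : Unique (s ∷ x ∷ y ∷ rest)
    u = proj₂ p
    x≢y : x ≢ y
    x≢y = Unique-∷⇒≢ (Unique-++⁻ʳ [ s ] u) (here refl)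
    x≢s : x ≢ s
    x≢s = ≢-sym (Unique-∷⇒≢ u (here refl))
    x≢t : x ≢ t
    x≢t = Unique-∷⇒≢ (Unique-++⁻ʳ [ s ] u) (there t∈rest)
    y≢s : y ≢ s
    y≢s = ≢-sym (Unique-∷⇒≢ u (there (here refl)))
    y≢t : y ≢ t
    y≢t = Unique-∷⇒≢ (Unique-++⁻ʳ (s ∷ x ∷ []) u) t∈rest

  arrival-on-path : s ≢ t → ∀ pre {x y} → SimplePathLe k s t (pre ++ x ∷ y ∷ t ∷ []) → s ∈ pre → OutA x y
  arrival-on-path s≢t pre {x} {y} p s∈pre =
    proj₁ x→y , distinct4 x≢y x≢s x≢t y≢s y≢t s≢t , x→y
    , SPG-edge⇒InEu (pre ∷ʳ x) [] (subst (SimplePathLe k s t) (sym (∷ʳ-++ pre x (y ∷ t ∷ []))) p)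
    where
    x→y : InEu x y
    x→y = SPG-edge⇒InEu pre [ t ] p
    u : Unique (x ∷ y ∷ t ∷ [])
    u = Unique-++⁻ʳ pre (proj₂ p)
    s∉ : s ∉ x ∷ y ∷ t ∷ []
    s∉ = Unique-++⇒disjoint pre (proj₂ p) s∈pre
    x≢y : x ≢ y
    x≢y = Unique-∷⇒≢ u (here refl)
    x≢s : x ≢ s
    x≢s x≡s = s∉ (here (sym x≡s))
    x≢t : x ≢ t
    x≢t = Unique-∷⇒≢ u (there (here refl))
    y≢s : y ≢ s
    y≢s y≡s = s∉ (there (here (sym y≡s)))
    y≢t : y ≢ t
    y≢t = Unique-∷⇒≢ (Unique-++⁻ʳ [ x ] u) (here refl)

  bridged-path : ∀ {v₁ v₂ vₗ₋₂ w} qs → Linked E qs → head qs ≡ just v₂ → last qs ≡ just vₗ₋₂ →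
                 InD v₂ v₁ → OutA vₗ₋₂ w → Linked E (s ∷ v₁ ∷ qs ++ w ∷ t ∷ [])
  bridged-path qs lk hd ls (v₁→v₂ , _ , (s→v₁ , _) , _) (vₗ₋₂→w , _ , _ , (w→t , _)) =
    s→v₁ ∷ Linked-bridge qs lk hd ls v₁→v₂ vₗ₋₂→w (w→t ∷ [-])

  EdgeIn-extend : ∀ {x y qs} xs ys → EdgeIn x y qs → EdgeIn x y (xs ++ qs ++ ys)
  EdgeIn-extend {x} {y} xs ys (as , bs , refl) = xs ++ as , bs ++ ys , (begin
    xs ++ (as ++ x ∷ y ∷ bs) ++ ys  ≡⟨ cong (xs ++_) (++-assoc as (x ∷ y ∷ bs) ys) ⟩
    xs ++ as ++ x ∷ y ∷ bs ++ ys    ≡⟨ ++-assoc xs as _ ⟨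
    (xs ++ as) ++ x ∷ y ∷ bs ++ ys  ∎)
    where open ≡-Reasoning

module Decidability {n : ℕ} (E : Rel (Fin n) 0ℓ) (E? : Decidable E) (s t : Fin n) (k : ℕ) where
  open Graph E s t k
  open Paths E s t k using (length≤)
  open import Data.List.Relation.Unary.Unique.DecPropositional (_≟_ {n}) using (unique?)
  open import Data.List.Membership.DecPropositional (_≟_ {n}) using (_∈?_; _∉?_)

  simplePathLe? : ∀ l x y ps → Dec (SimplePathLe l x y ps)
  simplePathLe? l x y ps =
    (linked? E? ps ×-dec ≡-dec _≟_ (head ps) (just x) ×-dec ≡-dec _≟_ (last ps) (just y) ×-dec length ps ≤? suc l)
    ×-dec unique? ps

  private
    Separated : Fin n → Fin n → ℕ → ℕ → Set
    Separated u v kf kb = kf + 1 + kb ≤ k × EVsExists kf u × EVtExists kb v × ¬ (∃[ w ] (EVs kf u w × EVt kb v w))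

  evsExists? : ∀ l u → Dec (EVsExists l u)
  evsExists? l u = bounded-∃? (λ ps → simplePathLe? l s u ps ×-dec t ∉? ps) (suc l) (λ (p , _) → length≤ p)

  evtExists? : ∀ l v → Dec (EVtExists l v)
  evtExists? l v = bounded-∃? (λ ps → simplePathLe? l v t ps ×-dec s ∉? ps) (suc l) (λ (p , _) → length≤ p)

  evs? : ∀ l u w → Dec (EVs l u w)
  evs? l u w = bounded-∀? (simplePathLe? l s u) (suc l) length≤ (λ ps → t ∉? ps →-dec w ∈? ps)

  evt? : ∀ l v w → Dec (EVt l v w)
  evt? l v w = bounded-∀? (simplePathLe? l v t) (suc l) length≤ (λ ps → s ∉? ps →-dec w ∈? ps)

  private
    separated? : ∀ u v kf kb → Dec (Separated u v kf kb)
    separated? u v kf kb =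
      kf + 1 + kb ≤? k ×-dec evsExists? kf u ×-dec evtExists? kb v ×-dec ¬? (anyFin? λ w → evs? kf u w ×-dec evt? kb v w)

  inEu? : ∀ u v → Dec (InEu u v)
  inEu? u v = E? u v ×-dec map′ drop-bounds add-bounds
    (anyUpTo? (λ kf → anyUpTo? (separated? u v kf) (suc k)) (suc k))
    where
    drop-bounds : ∃[ kf ] (kf < suc k × ∃[ kb ] (kb < suc k × Separated u v kf kb)) → ∃[ kf ] ∃[ kb ] Separated u v kf kb
    drop-bounds (kf , _ , kb , _ , sep) = kf , kb , sep
    add-bounds : ∃[ kf ] ∃[ kb ] Separated u v kf kb → ∃[ kf ] (kf < suc k × ∃[ kb ] (kb < suc k × Separated u v kf kb))
    add-bounds (kf , kb , sep@(le , _)) =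
      kf , s≤s (m+n≤o⇒m≤o kf (m+n≤o⇒m≤o (kf + 1) le)) , kb , s≤s (m+n≤o⇒n≤o (kf + 1) le) , sep

  inD? : ∀ w x → Dec (InD w x)
  inD? w x = E? x w ×-dec unique? _ ×-dec inEu? s x ×-dec inEu? x w

  moreThanInD? : ∀ w → Dec (MoreThan (k ∸ 2) (InD w))
  moreThanInD? w = moreThan? (inD? w) (k ∸ 2)

module HatIn {n : ℕ} (E : Rel (Fin n) 0ℓ) (E? : Decidable E) (s t : Fin n) (k : ℕ)
             (H : Fin n → Fin n → Set) (hat : Graph.IsHatIn E s t k H) where
  open Graph E s t k
  open Decidability E E? s t k using (moreThanInD?)

  hatIn⊆InD : ∀ {w x} → Dep w → H w x → InD w x
  hatIn⊆InD {w} {x} dep h with moreThanInD? w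
  ... | yes more = proj₂ (proj₁ (hat w dep) more) x h
  ... | no ¬more = Equivalence.to (proj₂ (hat w dep) ¬more x) h

  hatIn-avoiding : ∀ {w x zs} → InD w x → x ∉ zs → length zs < k ∸ 2 → ∃[ y ] (H w y × y ∉ zs)
  hatIn-avoiding {w} {x} {zs} x∈In x∉zs |zs|< with moreThanInD? w
  ... | no ¬more = x , Equivalence.from (proj₂ (hat w (x , x∈In)) ¬more x) x∈In , x∉zs
  ... | yes more with proj₁ (proj₁ (hat w (x , x∈In)) more)
  ... | ys , u , |ys| , ∈H⇔∈ys with unique-longer⇒∃∉ _≟_ u (≤-trans |zs|< (≤-reflexive (sym |ys|)))
  ... | y , y∈ys , y∉zs = y , Equivalence.from (∈H⇔∈ys y) y∈ys , y∉zs

module Characterization {n : ℕ} (E : Rel (Fin n) 0ℓ) (E? : Decidable E) (s t : Fin n) (s≢t : s ≢ t)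
                        (k : ℕ) (3≤k : 3 ≤ k) (H : Fin n → Fin n → Set) (hat : Graph.IsHatIn E s t k H) where
  open Graph E s t k
  open Paths E s t k
  open HatIn E E? s t k H hat

  reselect-departure : ∀ {v₁ q qs w} → SimplePathLe k s t (s ∷ v₁ ∷ q ∷ qs ++ w ∷ t ∷ []) → InD q v₁ →
                       length (q ∷ qs) ≤ k ∸ 3 → ∃[ y ] (H q y × Unique (s ∷ y ∷ q ∷ qs ++ w ∷ t ∷ []))
  reselect-departure {v₁} {q} {qs} {w} p v₁∈In |qs|≤ =
    reselect (hatIn-avoiding v₁∈In (v₁∉ ∘ there ∘ ∈-∷ʳ⇒∈-++-∷ qs) |qs∷ʳw|<)
    where
    v₁∉ : v₁ ∉ q ∷ qs ++ w ∷ t ∷ []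
    v₁∉ = Unique-++⇒disjoint (s ∷ v₁ ∷ []) (proj₂ p) (there (here refl))
    |qs∷ʳw|< : length (qs ∷ʳ w) < k ∸ 2
    |qs∷ʳw|< = ≤-<-trans (≤-trans (≤-reflexive (length-∷ʳ qs w)) |qs|≤) (∸3<∸2 3≤k)
    reselect : ∃[ y ] (H q y × y ∉ qs ∷ʳ w) → ∃[ y ] (H q y × Unique (s ∷ y ∷ q ∷ qs ++ w ∷ t ∷ []))
    reselect (y , h , y∉qs∷ʳw) with hatIn⊆InD (v₁ , v₁∈In) h
    ... | _ , (y≢q ∷ y≢s ∷ y≢t ∷ []) ∷ _ , _ =
      y , h , Unique-replace-second (proj₂ p) y≢s (∉-extend qs y≢q y∉qs∷ʳw y≢t)

  interior-path⇒Witness : ∀ {u v} v₁ qs w → SimplePathLe k s t (s ∷ v₁ ∷ qs ++ w ∷ t ∷ []) →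
                          EdgeIn u v qs → Witness H u v
  interior-path⇒Witness v₁ []       w p ([]    , _ , ())
  interior-path⇒Witness v₁ []       w p (_ ∷ _ , _ , ())
  interior-path⇒Witness v₁ (q ∷ qs) w p edge with snoc-view q qs
  ... | init , vₗ₋₂ , q∷qs≡init∷ʳvₗ₋₂ =
    let (y , h , unique) = reselect-departure p v₁∈In |q∷qs|≤ in
      q ∷ qs , q , vₗ₋₂
    , Linked-++⁻ˡ (q ∷ qs) (Linked-++⁻ʳ (s ∷ v₁ ∷ []) (linked p))
    , Unique-++⁻ˡ (q ∷ qs) (Unique-++⁻ʳ (s ∷ v₁ ∷ []) (proj₂ p))
    , refl , trans (cong last q∷qs≡init∷ʳvₗ₋₂) (last-++-∷ init vₗ₋₂ [])
    , |q∷qs|≤ , edge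
    , (v₁ , v₁∈In) , (w , w∈Out)
    , y , w , h , w∈Out , unique
    where
    v₁∈In : InD q v₁
    v₁∈In = departure-on-path s≢t (qs ++ w ∷ t ∷ []) p (last⇒∈ (qs ++ w ∷ t ∷ []) (last-++-∷ qs w [ t ]))
    w∈Out : OutA vₗ₋₂ w
    w∈Out = arrival-on-path s≢t (s ∷ v₁ ∷ init)
      (subst (SimplePathLe k s t)
        (trans (cong (λ zs → s ∷ v₁ ∷ zs ++ w ∷ t ∷ []) q∷qs≡init∷ʳvₗ₋₂) (cong (λ zs → s ∷ v₁ ∷ zs) (∷ʳ-++ init vₗ₋₂ _)))
        p)
      (here refl)
    |q∷qs|≤ : length (q ∷ qs) ≤ k ∸ 3
    |q∷qs|≤ = Equivalence.to (interior-length≤ s v₁ (q ∷ qs) w t 3≤k) (length≤ p)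

  Witness⇒InSPG : ∀ {u v} → Witness H u v → InSPG u v
  Witness⇒InSPG (qs , _ , _ , lk , _ , hd , ls , |qs|≤ , edge , dep , _ , v₁ , w , h , w∈Out , unique) =
      s ∷ v₁ ∷ qs ++ w ∷ t ∷ []
    , ( ( bridged-path qs lk hd ls (hatIn⊆InD dep h) w∈Out , refl , last-++-∷ (s ∷ v₁ ∷ qs) w [ t ]
        , Equivalence.from (interior-length≤ s v₁ qs w t 3≤k) |qs|≤)
      , unique)
    , EdgeIn-extend (s ∷ v₁ ∷ []) (w ∷ t ∷ []) edge

theorem11 : {n : ℕ} (E : Rel (Fin n) 0ℓ) → Decidable E → (s t : Fin n) → s ≢ t →
    (k : ℕ) → 5 ≤ k → (u v : Fin n) → Graph.Undetermined E s t k u v →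
    (H : Fin n → Fin n → Set) → Graph.IsHatIn E s t k H →
    (Graph.InSPG E s t k u v ⇔ Graph.Witness E s t k H u v)
theorem11 E E? s t s≢t k 5≤k u v (_ , ¬definite) H hat = mk⇔
  (λ spg → let (v₁ , qs , w , p , edge) = undetermined-edge-interior ¬definite spg
           in interior-path⇒Witness v₁ qs w p edge)
  Witness⇒InSPG
  where
  open Paths E s t k
  open Characterization E E? s t s≢t k (≤-trans (s≤s (s≤s (s≤s z≤n))) 5≤k) H hat
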